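{- Let $B=(b_{ij})\in\mathrm{M}_n(\mathbb{Z})$ be tracelike and suppose $4\mid n$. For $i=2,\dots,n$ let $c_i\in\mathbb{Z}$ satisfy $b_{ii}=b_{1i}^2+2c_i$. Let $C=(c'_{ij})\in\mathrm{M}_n(\mathbb{Z})$ be the matrix with $c'_{11}=n$, $c'_{1i}=c'_{i1}=b_{1i}$ for $i\ge 2$, $c'_{ii}=2c_i$ for $i\ge 2$, and $c'_{ij}=b_{ij}-b_{1i}b_{1j}$ for $2\le i\ne j\le n$. Then $C$ is a symmetric matrix with diagonal entries in $2\mathbb{Z}$ and $\det(B)\equiv\det(C)\pmod 4$.
   Context: A symmetric matrix $B=(b_{ij})_{i,j=1}^n\in\mathrm{M}_n(\mathbb{Z})$ is tracelike if $b_{11}=n$ and $b_{ii}\equiv b_{1i}^2\pmod 2$ for all $i=2,\dots,n$. -}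

module Defs where

open import Data.Nat using (ℕ; zero; suc)
open import Data.Fin using (Fin; zero; suc; punchIn; toℕ)
open import Data.Integer using (ℤ; +_; _+_; _*_; -_; _-_)
open import Data.Integer.Divisibility using (_∣_)
open import Data.Product using (_×_)
open import Relation.Binary.PropositionalEquality using (_≡_)
open import Relation.Nullary using (yes; no)

-- Square integer matrices of size n, entries indexed by Fin n (index 0 = paper's index 1).
Matrix : ℕ → Set
Matrix n = Fin n → Fin n → ℤ

∑ : ∀ {n} → (Fin n → ℤ) → ℤ
∑ {zero} f = + 0
∑ {suc n} f = f zero + ∑ (λ i → f (suc i))

sign : ℕ → ℤ
sign zero = + 1
sign (suc k) = - sign k

minor : ∀ {n} → Matrix (suc n) → Fin (suc n) → Fin (suc n) → Matrix n
minor A i j r c = A (punchIn i r) (punchIn j c)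

det : ∀ {n} → Matrix n → ℤ
det {zero} A = + 1
det {suc n} A = ∑ (λ j → sign (toℕ j) * (A zero j * det (minor A zero j)))

Symmetric : ∀ {n} → Matrix n → Set
Symmetric {n} A = ∀ (i j : Fin n) → A i j ≡ A j i

_≡_[mod_] : ℤ → ℤ → ℤ → Set
a ≡ b [mod m ] = m ∣ (a - b)

Tracelike : ∀ {m} → Matrix (suc m) → Set
Tracelike {m} B =
  Symmetric B × (B zero zero ≡ + suc m) ×
  (∀ (i : Fin m) → B (suc i) (suc i) ≡ B zero (suc i) * B zero (suc i) [mod + 2 ])

Cmat : ∀ {m} → Matrix (suc m) → (Fin m → ℤ) → Matrix (suc m)
Cmat {m} B c zero zero = + suc m
Cmat B c zero (suc j) = B zero (suc j)
Cmat B c (suc i) zero = B zero (suc i)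
Cmat B c (suc i) (suc j) with i Data.Fin.≟ j
... | yes _ = (+ 2) * c i
... | no _ = B (suc i) (suc j) - B zero (suc i) * B zero (suc j)

-- Subtracting b₁ᵢ times the first row from row i (i ≥ 2) does not change the
-- determinant, and turns B into a matrix that agrees with C except in the first
-- column, where the entry b₁ᵢ - b₁ᵢ n replaces b₁ᵢ; as 4 ∣ n these are congruent
-- mod 4, and the determinant, a polynomial in the entries, preserves entrywise
-- congruences. Invariance under the row operations comes from the Laplace
-- expansion along the first row: it is linear in each row, and expanding along
-- the first two rows shows that exchanging them negates the determinant, so a
-- matrix repeating its first row has determinant 0.
module Submission where

open import Defs
open import Data.Nat using (ℕ; suc; zero)
open import Data.Fin using (Fin; zero; suc; punchIn; toℕ)
open import Data.Fin.Properties using (suc-injective; _≟_)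
open import Data.Integer using (ℤ; +_; -[1+_]; _+_; _*_; -_; _-_)
open import Data.Integer.Properties using (*-zeroˡ; *-comm; +-inverseʳ; neg-distrib-+)
open import Data.Integer.Divisibility using (_∣_)
open import Data.Integer.Divisibility.Signed as Signed
  using (divides; ∣ᵤ⇒∣; ∣⇒∣ᵤ; ∣-trans; ∣m∣n⇒∣m+n; ∣n⇒∣m*n)
open import Data.Integer.Solver using (module +-*-Solver)
open import Data.Product using (_×_; _,_)
open import Data.Vec.Functional using (_∷_; tail; updateAt)
open import Data.Vec.Functional.Properties using (updateAt-updates; updateAt-minimal)
open import Relation.Binary.PropositionalEquality
open import Relation.Nullary using (yes; no)
open import Data.Empty using (⊥-elim)
open import Function using (_∘_)
open +-*-Solver

∑-cong : ∀ {n} {f g : Fin n → ℤ} → f ≗ g → ∑ f ≡ ∑ g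
∑-cong {zero} f≗g = refl
∑-cong {suc n} f≗g = cong₂ _+_ (f≗g zero) (∑-cong (λ i → f≗g (suc i)))

∑-zero : ∀ {n} {f : Fin n → ℤ} → (∀ i → f i ≡ + 0) → ∑ f ≡ + 0
∑-zero {zero} f≡0 = refl
∑-zero {suc n} f≡0 = cong₂ _+_ (f≡0 zero) (∑-zero (λ i → f≡0 (suc i)))

∑-distrib-+ : ∀ {n} (f g : Fin n → ℤ) → ∑ (λ i → f i + g i) ≡ ∑ f + ∑ g
∑-distrib-+ {zero} f g = refl
∑-distrib-+ {suc n} f g =
  trans (cong (_+_ (f zero + g zero)) (∑-distrib-+ (λ i → f (suc i)) (λ i → g (suc i))))
        (solve 4 (λ a b c d → (a :+ b) :+ (c :+ d) := (a :+ c) :+ (b :+ d)) refl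
               (f zero) (g zero) (∑ (λ i → f (suc i))) (∑ (λ i → g (suc i))))

*-distribˡ-∑ : ∀ {n} (x : ℤ) (f : Fin n → ℤ) → x * ∑ f ≡ ∑ (λ i → x * f i)
*-distribˡ-∑ {zero} x f = *-comm x (+ 0)
*-distribˡ-∑ {suc n} x f =
  trans (solve 3 (λ x a s → x :* (a :+ s) := x :* a :+ x :* s) refl x (f zero) (∑ (λ i → f (suc i))))
        (cong (_+_ (x * f zero)) (*-distribˡ-∑ x (λ i → f (suc i))))

∑-neg : ∀ {n} (f : Fin n → ℤ) → ∑ (λ i → - f i) ≡ - ∑ f
∑-neg {zero} f = refl
∑-neg {suc n} f =
  trans (cong (_+_ (- f zero)) (∑-neg (λ i → f (suc i)))) (sym (neg-distrib-+ (f zero) _))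

∑-linear : ∀ {n} (x : ℤ) {f g h : Fin n → ℤ} → (∀ i → f i ≡ g i + x * h i) →
           ∑ f ≡ ∑ g + x * ∑ h
∑-linear {zero} x e = sym (cong (_+_ (+ 0)) (*-comm x (+ 0)))
∑-linear {suc n} x {f} {g} {h} e =
  trans (cong₂ _+_ (e zero) (∑-linear x (λ i → e (suc i))))
        (solve 5 (λ x g₀ h₀ g h → (g₀ :+ x :* h₀) :+ (g :+ x :* h) := (g₀ :+ g) :+ x :* (h₀ :+ h)) refl
               x (g zero) (h zero) (∑ (λ i → g (suc i))) (∑ (λ i → h (suc i))))

∑-cong-mod : ∀ {n} (d : ℤ) {f g : Fin n → ℤ} → (∀ i → d Signed.∣ f i - g i) →
             d Signed.∣ ∑ f - ∑ g
∑-cong-mod {zero} d fg = divides (+ 0) (sym (*-zeroˡ d))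
∑-cong-mod {suc n} d {f} {g} fg =
  subst (d Signed.∣_)
        (solve 4 (λ a b s t → (a :- b) :+ (s :- t) := (a :+ s) :- (b :+ t)) refl
               (f zero) (g zero) (∑ (λ i → f (suc i))) (∑ (λ i → g (suc i))))
        (∣m∣n⇒∣m+n (fg zero) (∑-cong-mod d (λ i → fg (suc i))))

laplaceTerm : ∀ {n} → Matrix (suc n) → Fin (suc n) → ℤ
laplaceTerm A j = sign (toℕ j) * (A zero j * det (minor A zero j))

det-cong : ∀ {n} {A A′ : Matrix n} → (∀ i j → A i j ≡ A′ i j) → det A ≡ det A′
det-cong {zero} A≗A′ = refl
det-cong {suc n} A≗A′ = ∑-cong λ j →
  cong₂ (λ a d → sign (toℕ j) * (a * d))
        (A≗A′ zero j) (det-cong (λ r c → A≗A′ (suc r) (punchIn j c)))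

det-cong-mod : ∀ {n} (d : ℤ) {A A′ : Matrix n} → (∀ i j → d Signed.∣ A i j - A′ i j) →
               d Signed.∣ det A - det A′
det-cong-mod {zero} d A≡A′ = divides (+ 0) (sym (*-zeroˡ d))
det-cong-mod {suc n} d {A} {A′} A≡A′ = ∑-cong-mod d {laplaceTerm A} {laplaceTerm A′} λ j →
  let s = sign (toℕ j) ; a = A zero j ; a′ = A′ zero j
      M = det (minor A zero j) ; M′ = det (minor A′ zero j)
      M≡M′ = det-cong-mod d (λ r c → A≡A′ (suc r) (punchIn j c))
  in subst (d Signed.∣_)
       (solve 5 (λ s a a′ M M′ → s :* (M :* (a :- a′) :+ a′ :* (M :- M′)) := s :* (a :* M) :- s :* (a′ :* M′))
              refl s a a′ M M′)
       (∣n⇒∣m*n s (∣m∣n⇒∣m+n (∣n⇒∣m*n M (A≡A′ zero j)) (∣n⇒∣m*n a′ M≡M′)))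

det-linear-in-row : ∀ {n} (p : Fin (suc n)) (x : ℤ) {A A₁ A₂ : Matrix (suc n)} →
  (∀ j → A p j ≡ A₁ p j + x * A₂ p j) →
  (∀ i → i ≢ p → ∀ j → A i j ≡ A₁ i j) →
  (∀ i → i ≢ p → ∀ j → A i j ≡ A₂ i j) →
  det A ≡ det A₁ + x * det A₂
det-linear-in-row zero x {A} {A₁} {A₂} row-p rest₁ rest₂ =
  ∑-linear x {laplaceTerm A} {laplaceTerm A₁} {laplaceTerm A₂} λ j →
  let s = sign (toℕ j) ; M = det (minor A zero j)
      M≡M₁ = det-cong (λ r c → rest₁ (suc r) (λ ()) (punchIn j c))
      M≡M₂ = det-cong (λ r c → rest₂ (suc r) (λ ()) (punchIn j c))
  in begin
    s * (A zero j * M)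
  ≡⟨ cong (λ a → s * (a * M)) (row-p j) ⟩
    s * ((A₁ zero j + x * A₂ zero j) * M)
  ≡⟨ solve 5 (λ s a b x M → s :* ((a :+ x :* b) :* M) := s :* (a :* M) :+ x :* (s :* (b :* M)))
           refl s (A₁ zero j) (A₂ zero j) x M ⟩
    s * (A₁ zero j * M) + x * (s * (A₂ zero j * M))
  ≡⟨ cong₂ (λ M₁ M₂ → s * (A₁ zero j * M₁) + x * (s * (A₂ zero j * M₂))) M≡M₁ M≡M₂ ⟩
    s * (A₁ zero j * det (minor A₁ zero j)) + x * (s * (A₂ zero j * det (minor A₂ zero j)))
  ∎
  where open ≡-Reasoning
det-linear-in-row {suc n} (suc p) x {A} {A₁} {A₂} row-p rest₁ rest₂ =
  ∑-linear x {laplaceTerm A} {laplaceTerm A₁} {laplaceTerm A₂} λ j →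
  let s = sign (toℕ j)
      M≡ = det-linear-in-row p x (λ c → row-p (punchIn j c))
             (λ r r≢p → rest₁ (suc r) (r≢p ∘ suc-injective) ∘ punchIn j)
             (λ r r≢p → rest₂ (suc r) (r≢p ∘ suc-injective) ∘ punchIn j)
  in begin
    s * (A zero j * det (minor A zero j))
  ≡⟨ cong (λ d → s * (A zero j * d)) M≡ ⟩
    s * (A zero j * (det (minor A₁ zero j) + x * det (minor A₂ zero j)))
  ≡⟨ solve 5 (λ s a d₁ x d₂ → s :* (a :* (d₁ :+ x :* d₂)) := s :* (a :* d₁) :+ x :* (s :* (a :* d₂)))
           refl s (A zero j) (det (minor A₁ zero j)) x (det (minor A₂ zero j)) ⟩
    s * (A zero j * det (minor A₁ zero j)) + x * (s * (A zero j * det (minor A₂ zero j)))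
  ≡⟨ cong₂ (λ a₁ a₂ → s * (a₁ * det (minor A₁ zero j)) + x * (s * (a₂ * det (minor A₂ zero j))))
           (rest₁ zero (λ ()) j) (rest₂ zero (λ ()) j) ⟩
    s * (A₁ zero j * det (minor A₁ zero j)) + x * (s * (A₂ zero j * det (minor A₂ zero j)))
  ∎
  where open ≡-Reasoning

-- Once column punchIn j k is removed, j sits at position partner j k; hence
-- (j , k) ↦ (punchIn j k , partner j k) is the involution of the ordered pairs of
-- distinct columns that exchanges the two columns.
partner : ∀ {n} → Fin (suc n) → Fin n → Fin n
partner {suc n} zero k = zero
partner {suc n} (suc j) zero = j
partner {suc n} (suc j) (suc k) = suc (partner j k)

punchIn-partner : ∀ {n} (j : Fin (suc n)) (k : Fin n) → punchIn (punchIn j k) (partner j k) ≡ j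
punchIn-partner {suc n} zero k = refl
punchIn-partner {suc n} (suc j) zero = refl
punchIn-partner {suc n} (suc j) (suc k) = cong suc (punchIn-partner j k)

punchIn-punchIn-partner : ∀ {n} (j : Fin (suc (suc n))) (k : Fin (suc n)) (c : Fin n) →
  punchIn (punchIn j k) (punchIn (partner j k) c) ≡ punchIn j (punchIn k c)
punchIn-punchIn-partner zero k c = refl
punchIn-punchIn-partner (suc j) zero c = refl
punchIn-punchIn-partner (suc j) (suc k) zero = refl
punchIn-punchIn-partner (suc j) (suc k) (suc c) = cong suc (punchIn-punchIn-partner j k c)

sign-partner : ∀ {n} (j : Fin (suc n)) (k : Fin n) →
  sign (toℕ (punchIn j k)) * sign (toℕ (partner j k)) ≡ - (sign (toℕ j) * sign (toℕ k))
sign-partner {suc n} zero k =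
  solve 1 (λ s → (:- s) :* con (+ 1) := :- (con (+ 1) :* s)) refl (sign (toℕ k))
sign-partner {suc n} (suc j) zero =
  solve 1 (λ s → con (+ 1) :* s := :- ((:- s) :* con (+ 1))) refl (sign (toℕ j))
sign-partner {suc n} (suc j) (suc k) = begin
  - sign (toℕ (punchIn j k)) * - sign (toℕ (partner j k))
    ≡⟨ solve 2 (λ a b → (:- a) :* (:- b) := a :* b) refl (sign (toℕ (punchIn j k))) (sign (toℕ (partner j k))) ⟩
  sign (toℕ (punchIn j k)) * sign (toℕ (partner j k))
    ≡⟨ sign-partner j k ⟩
  - (sign (toℕ j) * sign (toℕ k))
    ≡⟨ cong -_ (solve 2 (λ a b → a :* b := (:- a) :* (:- b)) refl (sign (toℕ j)) (sign (toℕ k))) ⟩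
  - (- sign (toℕ j) * - sign (toℕ k))
    ∎
  where open ≡-Reasoning

∑-reindex-partner : ∀ {n} (h : Fin (suc n) → Fin n → ℤ) →
  ∑ (λ j → ∑ (λ k → h j k)) ≡ ∑ (λ j → ∑ (λ k → h (punchIn j k) (partner j k)))
∑-reindex-partner {zero} h = refl
∑-reindex-partner {suc n} h = begin
  X + ∑ (λ j → Y j + Z j)   ≡⟨ cong (_+_ X) (∑-distrib-+ Y Z) ⟩
  X + (∑ Y + ∑ Z)           ≡⟨ cong (λ t → X + (∑ Y + t)) (∑-reindex-partner (λ j k → h (suc j) (suc k))) ⟩
  X + (∑ Y + ∑ Z′)          ≡⟨ solve 3 (λ a b c → a :+ (b :+ c) := b :+ (a :+ c)) refl X (∑ Y) (∑ Z′) ⟩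
  ∑ Y + (X + ∑ Z′)          ≡⟨ cong (_+_ (∑ Y)) (sym (∑-distrib-+ (h zero) Z′)) ⟩
  ∑ Y + ∑ (λ j → h zero j + Z′ j)
    ∎
  where
  open ≡-Reasoning
  X = ∑ (h zero)
  Y = λ j → h (suc j) zero
  Z = λ j → ∑ (λ k → h (suc j) (suc k))
  Z′ = λ j → ∑ (λ k → h (suc (punchIn j k)) (suc (partner j k)))

laplaceTerm₂ : ∀ {n} → Matrix (suc (suc n)) → Fin (suc (suc n)) → Fin (suc n) → ℤ
laplaceTerm₂ A j k =
  sign (toℕ j) * (A zero j * (sign (toℕ k) * (A (suc zero) (punchIn j k) * det (minor (minor A zero j) zero k))))

det-expand₂ : ∀ {n} (A : Matrix (suc (suc n))) → det A ≡ ∑ (λ j → ∑ (laplaceTerm₂ A j))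
det-expand₂ A = ∑-cong λ j →
  trans (cong (sign (toℕ j) *_) (*-distribˡ-∑ (A zero j) (laplaceTerm (minor A zero j))))
        (*-distribˡ-∑ (sign (toℕ j)) (λ k → A zero j * laplaceTerm (minor A zero j) k))

swap₀₁ : ∀ {n} → Matrix (suc (suc n)) → Matrix (suc (suc n))
swap₀₁ A zero = A (suc zero)
swap₀₁ A (suc zero) = A zero
swap₀₁ A (suc (suc i)) = A (suc (suc i))

laplaceTerm₂-partner : ∀ {n} (A : Matrix (suc (suc n))) j k →
  laplaceTerm₂ A (punchIn j k) (partner j k) ≡ - laplaceTerm₂ (swap₀₁ A) j k
laplaceTerm₂-partner A j k = begin
  sb * (A zero b * (sk′ * (A (suc zero) (punchIn b k′) * det (minor (minor A zero b) zero k′))))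
    ≡⟨ cong₂ (λ c d → sb * (A zero b * (sk′ * (A (suc zero) c * d))))
             (punchIn-partner j k)
             (det-cong (λ r c → cong (A (suc (suc r))) (punchIn-punchIn-partner j k c))) ⟩
  sb * (A zero b * (sk′ * (A (suc zero) j * D)))
    ≡⟨ solve 5 (λ sb a₀ sk′ a₁ D → sb :* (a₀ :* (sk′ :* (a₁ :* D))) := (sb :* sk′) :* (a₁ :* a₀ :* D))
             refl sb (A zero b) sk′ (A (suc zero) j) D ⟩
  (sb * sk′) * (A (suc zero) j * A zero b * D)
    ≡⟨ cong (_* (A (suc zero) j * A zero b * D)) (sign-partner j k) ⟩
  - (sj * sk) * (A (suc zero) j * A zero b * D)
    ≡⟨ solve 5 (λ sj sk a₁ a₀ D → (:- (sj :* sk)) :* (a₁ :* a₀ :* D) := :- (sj :* (a₁ :* (sk :* (a₀ :* D)))))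
             refl sj sk (A (suc zero) j) (A zero b) D ⟩
  - laplaceTerm₂ (swap₀₁ A) j k
    ∎
  where
  open ≡-Reasoning
  b = punchIn j k
  k′ = partner j k
  sb = sign (toℕ b)
  sk′ = sign (toℕ k′)
  sj = sign (toℕ j)
  sk = sign (toℕ k)
  D = det (minor (minor (swap₀₁ A) zero j) zero k)

det≡-det-swap₀₁ : ∀ {n} (A : Matrix (suc (suc n))) → det A ≡ - det (swap₀₁ A)
det≡-det-swap₀₁ A = begin
  det A
    ≡⟨ det-expand₂ A ⟩
  ∑ (λ j → ∑ (laplaceTerm₂ A j))
    ≡⟨ ∑-reindex-partner (laplaceTerm₂ A) ⟩
  ∑ (λ j → ∑ (λ k → laplaceTerm₂ A (punchIn j k) (partner j k)))
    ≡⟨ ∑-cong (λ j → ∑-cong (laplaceTerm₂-partner A j)) ⟩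
  ∑ (λ j → ∑ (λ k → - laplaceTerm₂ (swap₀₁ A) j k))
    ≡⟨ ∑-cong (λ j → ∑-neg (laplaceTerm₂ (swap₀₁ A) j)) ⟩
  ∑ (λ j → - ∑ (laplaceTerm₂ (swap₀₁ A) j))
    ≡⟨ ∑-neg (λ j → ∑ (laplaceTerm₂ (swap₀₁ A) j)) ⟩
  - ∑ (λ j → ∑ (laplaceTerm₂ (swap₀₁ A) j))
    ≡⟨ cong -_ (sym (det-expand₂ (swap₀₁ A))) ⟩
  - det (swap₀₁ A)
    ∎
  where open ≡-Reasoning

i≡-i⇒i≡0 : ∀ i → i ≡ - i → i ≡ + 0
i≡-i⇒i≡0 (+ zero) _ = refl
i≡-i⇒i≡0 (+ suc n) ()
i≡-i⇒i≡0 -[1+ n ] ()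

det-repeated-row₀ : ∀ {n} (A : Matrix (suc n)) (p : Fin n) → (∀ j → A zero j ≡ A (suc p) j) → det A ≡ + 0
det-repeated-row₀ {suc n} A zero row₀≡row₁ =
  i≡-i⇒i≡0 (det A) (trans (det≡-det-swap₀₁ A) (cong -_ (det-cong swap₀₁A≗A)))
  where
  swap₀₁A≗A : ∀ i j → swap₀₁ A i j ≡ A i j
  swap₀₁A≗A zero j = sym (row₀≡row₁ j)
  swap₀₁A≗A (suc zero) j = row₀≡row₁ j
  swap₀₁A≗A (suc (suc i)) j = refl
det-repeated-row₀ {suc n} A (suc p) row₀≡row = trans (det≡-det-swap₀₁ A) (cong -_ det-swap₀₁≡0)
  where
  det-swap₀₁≡0 : det (swap₀₁ A) ≡ + 0
  det-swap₀₁≡0 = ∑-zero λ j →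
    trans (cong (λ d → sign (toℕ j) * (A (suc zero) j * d))
                (det-repeated-row₀ (minor (swap₀₁ A) zero j) p (row₀≡row ∘ punchIn j)))
          (solve 2 (λ s a → s :* (a :* con (+ 0)) := con (+ 0)) refl (sign (toℕ j)) (A (suc zero) j))

det-add-multiple-of-row₀ : ∀ {n} (p : Fin n) (x : ℤ) {A A′ : Matrix (suc n)} →
  (∀ j → A′ (suc p) j ≡ A (suc p) j + x * A zero j) →
  (∀ i → i ≢ suc p → ∀ j → A′ i j ≡ A i j) →
  det A′ ≡ det A
det-add-multiple-of-row₀ p x {A} {A′} row-p rest = begin
  det A′                  ≡⟨ det-linear-in-row (suc p) x row-p′ rest rest′ ⟩
  det A + x * det A₀      ≡⟨ cong (λ d → det A + x * d) (det-repeated-row₀ A₀ p (λ j → sym (A₀-row-p j))) ⟩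
  det A + x * + 0         ≡⟨ solve 2 (λ d x → d :+ x :* con (+ 0) := d) refl (det A) x ⟩
  det A                   ∎
  where
  open ≡-Reasoning
  A₀ = updateAt A (suc p) (λ _ → A zero)
  A₀-row-p : ∀ j → A₀ (suc p) j ≡ A zero j
  A₀-row-p = cong-app (updateAt-updates (suc p) A)
  row-p′ : ∀ j → A′ (suc p) j ≡ A (suc p) j + x * A₀ (suc p) j
  row-p′ j = trans (row-p j) (cong (λ a → A (suc p) j + x * a) (sym (A₀-row-p j)))
  rest′ : ∀ i → i ≢ suc p → ∀ j → A′ i j ≡ A₀ i j
  rest′ i i≢p j = trans (rest i i≢p j) (sym (cong-app (updateAt-minimal i (suc p) A i≢p) j))

coordinatewise-invariant⇒constant : ∀ {a b} {X : Set a} {Y : Set b} {n} (f : (Fin n → X) → Y) →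
  (∀ {u v} → u ≗ v → f u ≡ f v) →
  (∀ p {u v} → (∀ i → i ≢ p → u i ≡ v i) → f u ≡ f v) →
  ∀ u v → f u ≡ f v
coordinatewise-invariant⇒constant {n = zero} f f-cong _ u v = f-cong (λ ())
coordinatewise-invariant⇒constant {n = suc n} f f-cong f-inv u v = begin
  f u                    ≡⟨ f-inv zero off-zero ⟩
  f (v zero ∷ tail u)    ≡⟨ coordinatewise-invariant⇒constant (λ t → f (v zero ∷ t))
                              (λ t≗t′ → f-cong (∷-cong t≗t′)) (λ p → f-inv (suc p) ∘ off-suc) (tail u) (tail v) ⟩
  f (v zero ∷ tail v)    ≡⟨ f-cong (λ { zero → refl ; (suc i) → refl }) ⟩
  f v                    ∎
  where
  open ≡-Reasoning
  off-zero : ∀ i → i ≢ zero → u i ≡ (v zero ∷ tail u) i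
  off-zero zero 0≢0 = ⊥-elim (0≢0 refl)
  off-zero (suc i) _ = refl
  ∷-cong : ∀ {t t′} → t ≗ t′ → v zero ∷ t ≗ v zero ∷ t′
  ∷-cong t≗t′ zero = refl
  ∷-cong t≗t′ (suc i) = t≗t′ i
  off-suc : ∀ {p t t′} → (∀ i → i ≢ p → t i ≡ t′ i) → ∀ i → i ≢ suc p → (v zero ∷ t) i ≡ (v zero ∷ t′) i
  off-suc t≡t′ zero _ = refl
  off-suc t≡t′ (suc i) i≢p = t≡t′ i (i≢p ∘ cong suc)

addRow₀ : ∀ {n} → Matrix (suc n) → (Fin n → ℤ) → Matrix (suc n)
addRow₀ A w zero j = A zero j
addRow₀ A w (suc i) j = A (suc i) j + w i * A zero j

det-addRow₀ : ∀ {n} (A : Matrix (suc n)) (w : Fin n → ℤ) → det (addRow₀ A w) ≡ det A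
det-addRow₀ A w = trans
  (coordinatewise-invariant⇒constant (det ∘ addRow₀ A) det-addRow₀-cong det-addRow₀-update w (λ _ → + 0))
  (det-cong no-op)
  where
  det-addRow₀-cong : ∀ {u v} → u ≗ v → det (addRow₀ A u) ≡ det (addRow₀ A v)
  det-addRow₀-cong {u} {v} u≗v = det-cong {A = addRow₀ A u} {addRow₀ A v} λ
    { zero j → refl
    ; (suc i) j → cong (λ y → A (suc i) j + y * A zero j) (u≗v i) }
  det-addRow₀-update : ∀ p {u v} → (∀ i → i ≢ p → u i ≡ v i) → det (addRow₀ A u) ≡ det (addRow₀ A v)
  det-addRow₀-update p {u} {v} u≡v = det-add-multiple-of-row₀ p (u p - v p) {addRow₀ A v} {addRow₀ A u}
    (λ j → solve 4 (λ a a₀ x y → a :+ x :* a₀ := (a :+ y :* a₀) :+ (x :- y) :* a₀)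
                   refl (A (suc p) j) (A zero j) (u p) (v p))
    λ { zero _ j → refl
      ; (suc i) i≢p j → cong (λ y → A (suc i) j + y * A zero j) (u≡v i (i≢p ∘ cong suc)) }
  no-op : ∀ i j → addRow₀ A (λ _ → + 0) i j ≡ A i j
  no-op zero j = refl
  no-op (suc i) j = solve 2 (λ a a₀ → a :+ con (+ 0) :* a₀ := a) refl (A (suc i) j) (A zero j)

≡⇒∣-difference : ∀ (d : ℤ) {x y} → x ≡ y → d Signed.∣ x - y
≡⇒∣-difference d {y = y} refl = divides (+ 0) (trans (+-inverseʳ y) (sym (*-zeroˡ d)))

symmetric-Cmat : ∀ {m} (B : Matrix (suc m)) (c : Fin m → ℤ) → Symmetric B → Symmetric (Cmat B c)
symmetric-Cmat B c B-sym zero zero = refl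
symmetric-Cmat B c B-sym zero (suc j) = refl
symmetric-Cmat B c B-sym (suc i) zero = refl
symmetric-Cmat B c B-sym (suc i) (suc j) with i ≟ j | j ≟ i
... | yes refl | yes _ = refl
... | yes i≡j | no j≢i = ⊥-elim (j≢i (sym i≡j))
... | no i≢j | yes j≡i = ⊥-elim (i≢j (sym j≡i))
... | no _ | no _ = cong₂ _-_ (B-sym (suc i) (suc j)) (*-comm (B zero (suc i)) (B zero (suc j)))

2∣Cmat-diagonal : ∀ {m} (B : Matrix (suc m)) (c : Fin m → ℤ) i → + 2 Signed.∣ Cmat B c (suc i) (suc i)
2∣Cmat-diagonal B c i with i ≟ i
... | yes _ = divides (c i) (*-comm (+ 2) (c i))
... | no i≢i = ⊥-elim (i≢i refl)

rowReduced : ∀ {m} → Matrix (suc m) → Matrix (suc m)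
rowReduced B = addRow₀ B (λ i → - B zero (suc i))

module _ {m} (B : Matrix (suc m)) (c : Fin m → ℤ)
         (c-def : ∀ i → B (suc i) (suc i) ≡ B zero (suc i) * B zero (suc i) + + 2 * c i) where

  rowReduced-suc-suc : ∀ i j → rowReduced B (suc i) (suc j) ≡ Cmat B c (suc i) (suc j)
  rowReduced-suc-suc i j with i ≟ j
  ... | yes refl = trans (cong (λ b → b + - B zero (suc i) * B zero (suc i)) (c-def i))
    (solve 2 (λ b c → b :* b :+ con (+ 2) :* c :+ (:- b) :* b := con (+ 2) :* c) refl (B zero (suc i)) (c i))
  ... | no _ =
    solve 3 (λ b x y → b :+ (:- x) :* y := b :- x :* y) refl (B (suc i) (suc j)) (B zero (suc i)) (B zero (suc j))

  rowReduced≡Cmat-mod : Symmetric B → B zero zero ≡ + suc m →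
    ∀ d → d Signed.∣ + suc m → ∀ i j → d Signed.∣ rowReduced B i j - Cmat B c i j
  rowReduced≡Cmat-mod B-sym B₀₀≡n d d∣n zero zero = ≡⇒∣-difference d B₀₀≡n
  rowReduced≡Cmat-mod B-sym B₀₀≡n d d∣n zero (suc j) = ≡⇒∣-difference d {B zero (suc j)} refl
  rowReduced≡Cmat-mod B-sym B₀₀≡n d d∣n (suc i) zero = subst (d Signed.∣_) first-column (∣n⇒∣m*n (- b) d∣n)
    where
    b = B zero (suc i)
    first-column : - b * + suc m ≡ rowReduced B (suc i) zero - b
    first-column = trans (solve 2 (λ b n → (:- b) :* n := (b :+ (:- b) :* n) :- b) refl b (+ suc m))
      (cong₂ (λ x y → (x + - b * y) - b) (sym (B-sym (suc i) zero)) (sym B₀₀≡n))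
  rowReduced≡Cmat-mod B-sym B₀₀≡n d d∣n (suc i) (suc j) = ≡⇒∣-difference d (rowReduced-suc-suc i j)

lemma3p6 : (m : ℕ) (B : Matrix (suc m)) → Tracelike B → (+ 4) ∣ (+ suc m) →
    (c : Fin m → ℤ) →
    (∀ (i : Fin m) → B (suc i) (suc i) ≡ B zero (suc i) * B zero (suc i) + (+ 2) * c i) →
    Symmetric (Cmat B c) × (∀ (i : Fin (suc m)) → (+ 2) ∣ Cmat B c i i) ×
      (det B ≡ det (Cmat B c) [mod + 4 ])
lemma3p6 m B (B-sym , B₀₀≡n , _) 4∣n c c-def = symmetric-Cmat B c B-sym , 2∣diagonal , ∣⇒∣ᵤ det-congruence
  where
  4∣n′ : + 4 Signed.∣ + suc m
  4∣n′ = ∣ᵤ⇒∣ 4∣n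
  2∣4 : + 2 Signed.∣ + 4
  2∣4 = divides (+ 2) refl
  2∣diagonal : ∀ i → + 2 ∣ Cmat B c i i
  2∣diagonal zero = ∣⇒∣ᵤ (∣-trans 2∣4 4∣n′)
  2∣diagonal (suc i) = ∣⇒∣ᵤ (2∣Cmat-diagonal B c i)
  det-congruence : + 4 Signed.∣ det B - det (Cmat B c)
  det-congruence = subst (λ x → + 4 Signed.∣ x - det (Cmat B c)) (det-addRow₀ B (λ i → - B zero (suc i)))
    (det-cong-mod (+ 4) {rowReduced B} {Cmat B c} (rowReduced≡Cmat-mod B c c-def B-sym B₀₀≡n (+ 4) 4∣n′))
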